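{- Let $d$ be a positive even integer and $i$ a positive integer. Then $(-1)^{i-1}C_i^{(d)}$ equals the number of lattice walks from $(0,0)$ to $\left(\frac{d}{2}+1,\frac{d(i-1)}{2}\right)$ using only unit steps $(1,0)$ and $(0,1)$, such that for each $j$ with $0\leq j\leq i-2$ there are fewer than $\frac{d}{2}$ up steps $(0,1)$ taken at $x$-coordinate $j$. Here \[ C_i^{(d)}=\sum_{k=0}^{i-1}\binom{i-1}{k}(-1)^k\frac{\Gamma\left(\frac{d}{2}(k+1)+2\right)}{\Gamma\left(\frac{d}{2}+2\right)\Gamma\left(1+\frac{dk}{2}\right)}. \] -}

module Defs where

open import Data.Bool using (Bool; true; false; _∧_; T?)
open import Data.Nat using (ℕ; zero; suc; _+_; _*_; _∸_; _/_; _!; _≡ᵇ_; _<ᵇ_)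
open import Data.Nat.Properties using (_!*_!≢0)
open import Data.Nat.Combinatorics using (_C_)
open import Data.Integer as ℤ using (ℤ; +_)
open import Data.Rational as ℚ using (ℚ; 0ℚ)
open import Data.List using (List; []; _∷_; upTo; foldr; filter; length; concatMap)

-- Gamma function at positive integer arguments: Γ(n) = (n-1)!  (n ≥ 1).
-- (All Gamma arguments in C_i^{(d)} are positive integers when d is even.)
Γ⁺ : ℕ → ℕ
Γ⁺ n = (n ∸ 1) !

Γratio : ℕ → ℕ → ℕ → ℚ
Γratio a b c = ((+ Γ⁺ a) ℚ./ (Γ⁺ b * Γ⁺ c)) {{ (b ∸ 1) !* (c ∸ 1) !≢0 }}

Σ< : ℕ → (ℕ → ℚ) → ℚ
Σ< n f = foldr (λ k acc → f k ℚ.+ acc) 0ℚ (upTo n)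

-1ℤ : ℤ
-1ℤ = ℤ.- (+ 1)

-- C_i^{(d)} = Σ_{k=0}^{i-1} binom(i-1,k) (-1)^k Γ(d/2 (k+1) + 2) / (Γ(d/2 + 2) Γ(1 + d k / 2))
-- (d is even, so d k / 2 = (d/2) k.)
Cᵈ : (d i : ℕ) → ℚ
Cᵈ d i = Σ< i λ k →
  ((+ ((i ∸ 1) C k) ℤ.* (-1ℤ ℤ.^ k)) ℚ./ 1)
    ℚ.* Γratio (h * (k + 1) + 2) (h + 2) (1 + h * k)
  where h = d / 2

-- Lattice walks: sequences of unit steps, R = (1,0), U = (0,1), starting at (0,0).
data Step : Set where
  R U : Step

allSeqs : ℕ → List (List Step)
allSeqs zero = [] ∷ []
allSeqs (suc n) = concatMap (λ s → (R ∷ s) ∷ (U ∷ s) ∷ []) (allSeqs n)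

numR numU : List Step → ℕ
numR [] = 0
numR (R ∷ s) = suc (numR s)
numR (U ∷ s) = numR s
numU [] = 0
numU (R ∷ s) = numU s
numU (U ∷ s) = suc (numU s)

upsAt : ℕ → List Step → ℕ
upsAt j [] = 0
upsAt zero (R ∷ s) = 0
upsAt (suc j) (R ∷ s) = upsAt j s
upsAt zero (U ∷ s) = suc (upsAt zero s)
upsAt (suc j) (U ∷ s) = upsAt (suc j) s

allB : (ℕ → Bool) → List ℕ → Bool
allB p = foldr (λ x acc → p x ∧ acc) true

goodWalk : (a b i h : ℕ) → List Step → Bool
goodWalk a b i h w =
  (numR w ≡ᵇ a) ∧ (numU w ≡ᵇ b) ∧ allB (λ j → upsAt j w <ᵇ h) (upTo (i ∸ 1))

numWalks : (d i : ℕ) → ℕ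
numWalks d i = length (filter (λ w → T? (goodWalk a b i h w)) (allSeqs (a + b)))
  where
  h = d / 2
  a = h + 1
  b = (d * (i ∸ 1)) / 2

-- Write h = d/2 and n = i − 1. The Gamma quotient in the k-th term of C_i^{(d)} is the binomial
-- coefficient C(h+1+hk, h+1), the number of unrestricted walks to (h+1, hk). Let D(n, x) count the
-- walks to (h+1, h(x+n)) whose columns 0, …, n−1 carry fewer than h up steps each. Among the walks
-- counted by D(n, x+1), those whose column n also carries fewer than h up steps are counted by
-- D(n+1, x), and deleting h up steps from column n maps the others bijectively onto the walks counted
-- by D(n, x) (if column n does not exist, all three counts vanish). Hence D(n+1, x) = D(n, x+1) − D(n, x),
-- so D(n, ·) is the n-th forward difference of D(0, ·), and D(n, 0) = (−1)^n Σ_k C(n,k) (−1)^k D(0, k)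
-- is the claim.

module Submission where

open import Defs
open import Data.Nat using (ℕ; _<_; _∸_)
open import Data.Nat.Divisibility using (_∣_)
open import Data.Integer as ℤ using (+_)
open import Data.Rational as ℚ using (ℚ)
open import Relation.Binary.PropositionalEquality using (_≡_)
import Data.Nat as ℕ
import Data.Nat.Properties as ℕ
open import Data.Nat using (zero; suc)
open import Data.Nat.Divisibility using (divides)
open import Data.Nat.DivMod using (m*n/n≡m)
open import Relation.Binary.PropositionalEquality using (refl; cong; cong₂; trans; sym; subst; module ≡-Reasoning)

module _ where
  open import Data.Nat.Properties using (n<1+n; +-suc)
  open import Data.Nat.Combinatorics using (_C_; nCk+nC[k+1]≡[n+1]C[k+1]; k>n⇒nCk≡0)
  open import Data.Integer using (ℤ; -_; _+_; _-_; _*_; _^_)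
  open import Data.Integer.Properties using (+-assoc; +-comm; +-identityʳ; neg-distrib-+; pos-+; +-commutativeSemigroup)
  open import Algebra.Properties.CommutativeSemigroup +-commutativeSemigroup
    using () renaming (interchange to +-interchange)
  open import Data.Integer.Tactic.RingSolver using (solve-∀)
  open import Function using (_∘_)
  open ≡-Reasoning

  ∑ : ℕ → (ℕ → ℤ) → ℤ
  ∑ zero    f = + 0
  ∑ (suc n) f = f 0 + ∑ n (f ∘ suc)

  ∑-cong : ∀ n {f g : ℕ → ℤ} → (∀ k → f k ≡ g k) → ∑ n f ≡ ∑ n g
  ∑-cong zero    f≗g = refl
  ∑-cong (suc n) f≗g = cong₂ _+_ (f≗g 0) (∑-cong n (f≗g ∘ suc))

  ∑-+ : ∀ n (f g : ℕ → ℤ) → ∑ n (λ k → f k + g k) ≡ ∑ n f + ∑ n g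
  ∑-+ zero    f g = refl
  ∑-+ (suc n) f g = begin
    (f 0 + g 0) + ∑ n (λ k → f (suc k) + g (suc k))
      ≡⟨ cong (_+_ (f 0 + g 0)) (∑-+ n (f ∘ suc) (g ∘ suc)) ⟩
    (f 0 + g 0) + (∑ n (f ∘ suc) + ∑ n (g ∘ suc))
      ≡⟨ +-interchange (f 0) (g 0) _ _ ⟩
    (f 0 + ∑ n (f ∘ suc)) + (g 0 + ∑ n (g ∘ suc)) ∎

  ∑-neg : ∀ n (f : ℕ → ℤ) → ∑ n (λ k → - f k) ≡ - ∑ n f
  ∑-neg zero    f = refl
  ∑-neg (suc n) f = trans (cong (_+_ (- f 0)) (∑-neg n (f ∘ suc))) (sym (neg-distrib-+ (f 0) _))

  ∑-last : ∀ n (f : ℕ → ℤ) → ∑ (suc n) f ≡ ∑ n f + f n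
  ∑-last zero    f = +-comm (f 0) (+ 0)
  ∑-last (suc n) f = trans (cong (_+_ (f 0)) (∑-last n (f ∘ suc))) (sym (+-assoc (f 0) _ _))

  binomialTerm : ℕ → (ℕ → ℤ) → ℕ → ℤ
  binomialTerm n g k = (+ (n C k) * (-1ℤ ^ k)) * g k

  altBinomialSum : ℕ → (ℕ → ℤ) → ℤ
  altBinomialSum n g = ∑ (suc n) (binomialTerm n g)

  binomialTerm-pascal : ∀ n g k →
    binomialTerm (suc n) g (suc k) ≡ binomialTerm n g (suc k) + - binomialTerm n (g ∘ suc) k
  binomialTerm-pascal n g k = begin
    (+ (suc n C suc k) * (-1ℤ * s)) * g (suc k)
      ≡⟨ cong (λ c → (+ c * (-1ℤ * s)) * g (suc k)) (sym (nCk+nC[k+1]≡[n+1]C[k+1] n k)) ⟩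
    (+ (n C k ℕ.+ n C suc k) * (-1ℤ * s)) * g (suc k)
      ≡⟨ cong (λ c → (c * (-1ℤ * s)) * g (suc k)) (pos-+ (n C k) (n C suc k)) ⟩
    ((+ (n C k) + + (n C suc k)) * (-1ℤ * s)) * g (suc k)
      ≡⟨ distribute (+ (n C k)) (+ (n C suc k)) s (g (suc k)) ⟩
    (+ (n C suc k) * (-1ℤ * s)) * g (suc k) + - ((+ (n C k) * s) * g (suc k)) ∎
    where
    s = -1ℤ ^ k
    distribute : ∀ a b s x → ((a + b) * (-1ℤ * s)) * x ≡ (b * (-1ℤ * s)) * x + - ((a * s) * x)
    distribute = solve-∀

  altBinomialSum-suc : ∀ n g → altBinomialSum (suc n) g ≡ altBinomialSum n g - altBinomialSum n (g ∘ suc)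
  altBinomialSum-suc n g = begin
    t 0 + ∑ (suc n) (binomialTerm (suc n) g ∘ suc)
      ≡⟨ cong (_+_ (t 0)) (∑-cong (suc n) (binomialTerm-pascal n g)) ⟩
    t 0 + ∑ (suc n) (λ k → t (suc k) + - binomialTerm n (g ∘ suc) k)
      ≡⟨ cong (_+_ (t 0)) (∑-+ (suc n) (t ∘ suc) (λ k → - binomialTerm n (g ∘ suc) k)) ⟩
    t 0 + (∑ (suc n) (t ∘ suc) + ∑ (suc n) (λ k → - binomialTerm n (g ∘ suc) k))
      ≡⟨ cong₂ (λ x y → t 0 + (x + y)) (∑-last n (t ∘ suc)) (∑-neg (suc n) (binomialTerm n (g ∘ suc))) ⟩
    t 0 + ((∑ n (t ∘ suc) + t (suc n)) - altBinomialSum n (g ∘ suc))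
      ≡⟨ cong (λ x → t 0 + ((∑ n (t ∘ suc) + x) - altBinomialSum n (g ∘ suc))) t[n+1]≡0 ⟩
    t 0 + ((∑ n (t ∘ suc) + + 0) - altBinomialSum n (g ∘ suc))
      ≡⟨ cong (λ x → t 0 + (x - altBinomialSum n (g ∘ suc))) (+-identityʳ (∑ n (t ∘ suc))) ⟩
    t 0 + (∑ n (t ∘ suc) - altBinomialSum n (g ∘ suc))
      ≡⟨ +-assoc (t 0) _ _ ⟨
    (t 0 + ∑ n (t ∘ suc)) - altBinomialSum n (g ∘ suc) ∎
    where
    t = binomialTerm n g
    t[n+1]≡0 : t (suc n) ≡ + 0
    t[n+1]≡0 = cong (λ c → (+ c * (-1ℤ ^ suc n)) * g (suc n)) (k>n⇒nCk≡0 (n<1+n n))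

  altBinomialSum-cong : ∀ n {f g : ℕ → ℤ} → (∀ k → f k ≡ g k) → altBinomialSum n f ≡ altBinomialSum n g
  altBinomialSum-cong n f≗g = ∑-cong (suc n) (λ k → cong (+ (n C k) * (-1ℤ ^ k) *_) (f≗g k))

  altBinomialSum-forwardDifference : (D : ℕ → ℕ → ℕ) → (∀ n x → D n (suc x) ≡ D (suc n) x ℕ.+ D n x) →
    ∀ n x → (-1ℤ ^ n) * altBinomialSum n (λ k → + D 0 (x ℕ.+ k)) ≡ + D n x
  altBinomialSum-forwardDifference D step zero x =
    trans (oneTerm (+ D 0 (x ℕ.+ 0))) (cong (λ m → + D 0 m) (ℕ.+-identityʳ x))
    where
    oneTerm : ∀ a → + 1 * ((+ 1 * + 1) * a + + 0) ≡ a
    oneTerm = solve-∀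
  altBinomialSum-forwardDifference D step (suc n) x = begin
    (-1ℤ * s) * altBinomialSum (suc n) g
      ≡⟨ cong ((-1ℤ * s) *_) (altBinomialSum-suc n g) ⟩
    (-1ℤ * s) * (altBinomialSum n g - altBinomialSum n (g ∘ suc))
      ≡⟨ flipSign s _ _ ⟩
    s * altBinomialSum n (g ∘ suc) - s * altBinomialSum n g
      ≡⟨ cong₂ _-_ shifted (altBinomialSum-forwardDifference D step n x) ⟩
    + D n (suc x) - + D n x
      ≡⟨ cong (λ m → + m - + D n x) (step n x) ⟩
    + (D (suc n) x ℕ.+ D n x) - + D n x
      ≡⟨ cong (_- + D n x) (pos-+ (D (suc n) x) (D n x)) ⟩
    (+ D (suc n) x + + D n x) - + D n x
      ≡⟨ cancel (+ D (suc n) x) (+ D n x) ⟩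
    + D (suc n) x ∎
    where
    s = -1ℤ ^ n
    g = λ k → + D 0 (x ℕ.+ k)
    shifted : s * altBinomialSum n (g ∘ suc) ≡ + D n (suc x)
    shifted = trans (cong (s *_) (altBinomialSum-cong n (λ k → cong (λ m → + D 0 m) (+-suc x k))))
                    (altBinomialSum-forwardDifference D step n (suc x))
    flipSign : ∀ s p q → (-1ℤ * s) * (p - q) ≡ s * q - s * p
    flipSign = solve-∀
    cancel : ∀ a b → (a + b) - b ≡ a
    cancel = solve-∀

module _ where
  open import Data.List using (upTo; applyUpTo; map; foldr)
  open import Data.List.Properties using (foldr-map; map-upTo)
  open import Data.Nat using (_+_; _*_; _!; _≤_; z≤n; s≤s; NonZero)
  open import Data.Nat.Properties using (+-∸-assoc; m+n∸m≡n; m≤m+n; _!*_!≢0)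
  open import Data.Nat.Combinatorics using (_C_; nCk≡n!/k![n-k]!; k![n∸k]!∣n!)
  open import Data.Nat.DivMod using (m/n*n≡m)
  open import Data.Nat.Coprimality using (1-coprimeTo) renaming (sym to coprime-sym)
  open import Data.Nat.Tactic.RingSolver using (solve-∀)
  open import Data.Integer using (ℤ)
  open import Data.Integer.Properties using (*-identityʳ; pos-*)
  open import Data.Rational using (mkℚ; 0ℚ; _/_)
  open import Data.Rational.Properties using (↥p/↧p≡p; /-cong; 0/n≡0; fromℚᵘ-cong)
  open import Data.Rational.Unnormalised using (*≡*; mkℚᵘ)
  open ≡-Reasoning

  fromℤ : ℤ → ℚ
  fromℤ z = z / 1

  fromℤ≡mkℚ : ∀ z → fromℤ z ≡ mkℚ z 0 (coprime-sym (1-coprimeTo ℤ.∣ z ∣))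
  fromℤ≡mkℚ z = ↥p/↧p≡p (mkℚ z 0 (coprime-sym (1-coprimeTo ℤ.∣ z ∣)))

  fromℤ-+ : ∀ p q → fromℤ (p ℤ.+ q) ≡ fromℤ p ℚ.+ fromℤ q
  fromℤ-+ p q = begin
    (p ℤ.+ q) / 1
      ≡⟨ /-cong (sym (cong₂ ℤ._+_ (*-identityʳ p) (*-identityʳ q))) refl ⟩
    (p ℤ.* + 1 ℤ.+ q ℤ.* + 1) / (1 * 1)
      ≡⟨ cong₂ ℚ._+_ (fromℤ≡mkℚ p) (fromℤ≡mkℚ q) ⟨
    fromℤ p ℚ.+ fromℤ q ∎

  fromℤ-* : ∀ p q → fromℤ (p ℤ.* q) ≡ fromℤ p ℚ.* fromℤ q
  fromℤ-* p q = sym (cong₂ ℚ._*_ (fromℤ≡mkℚ p) (fromℤ≡mkℚ q))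

  +[c*m]/m≡fromℤ[c] : ∀ c m .{{_ : NonZero m}} → (+ (c * m)) / m ≡ fromℤ (+ c)
  +[c*m]/m≡fromℤ[c] c (suc m) =
    fromℚᵘ-cong {mkℚᵘ (+ (c * suc m)) m} {mkℚᵘ (+ c) 0}
      (*≡* (trans (*-identityʳ _) (pos-* c (suc m))))

  Σ<-suc : ∀ n f → Σ< (suc n) f ≡ f 0 ℚ.+ Σ< n (λ k → f (suc k))
  Σ<-suc n f = cong (f 0 ℚ.+_) (begin
    foldr F 0ℚ (applyUpTo suc n)   ≡⟨ cong (foldr F 0ℚ) (map-upTo suc n) ⟨
    foldr F 0ℚ (map suc (upTo n))  ≡⟨ foldr-map F suc 0ℚ (upTo n) ⟩
    Σ< n (λ k → f (suc k))         ∎)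
    where F = λ k acc → f k ℚ.+ acc

  Σ<-fromℤ : ∀ n {f : ℕ → ℚ} {g : ℕ → ℤ} → (∀ k → f k ≡ fromℤ (g k)) → Σ< n f ≡ fromℤ (∑ n g)
  Σ<-fromℤ zero    f≗g = sym (0/n≡0 1)
  Σ<-fromℤ (suc n) {f} {g} f≗g = begin
    Σ< (suc n) f
      ≡⟨ Σ<-suc n f ⟩
    f 0 ℚ.+ Σ< n (λ k → f (suc k))
      ≡⟨ cong₂ ℚ._+_ (f≗g 0) (Σ<-fromℤ n (λ k → f≗g (suc k))) ⟩
    fromℤ (g 0) ℚ.+ fromℤ (∑ n (λ k → g (suc k)))
      ≡⟨ fromℤ-+ (g 0) _ ⟨
    fromℤ (∑ (suc n) g) ∎

  nCk*k![n∸k]!≡n! : ∀ {n k} → k ≤ n → (n C k) * (k ! * (n ∸ k) !) ≡ n !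
  nCk*k![n∸k]!≡n! {n} {k} k≤n =
    trans (cong (_* (k ! * (n ∸ k) !)) (nCk≡n!/k![n-k]! k≤n)) (m/n*n≡m (k![n∸k]!∣n! k≤n))
    where instance _ = k !* (n ∸ k) !≢0

  unrestrictedWalks : ℕ → ℕ → ℕ
  unrestrictedWalks h k = (h + 1 + h * k) C (h + 1)

  Γratio≡unrestrictedWalks : ∀ h k →
    Γratio (h * (k + 1) + 2) (h + 2) (1 + h * k) ≡ fromℤ (+ unrestrictedWalks h k)
  Γratio≡unrestrictedWalks h k = begin
    Γratio (h * (k + 1) + 2) (h + 2) (1 + h * k)           ≡⟨ /-cong (cong +_ numerator) denominator ⟩
    (+ ((n C r) * (r ! * (h * k) !))) / (r ! * (h * k) !)  ≡⟨ +[c*m]/m≡fromℤ[c] (n C r) _ ⟩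
    fromℤ (+ (n C r))                                      ∎
    where
    r = h + 1
    n = r + h * k
    instance
      _ = (h + 2 ∸ 1) !* (h * k) !≢0
      _ = r !* (h * k) !≢0
    m+2∸1≡m+1 : ∀ m → m + 2 ∸ 1 ≡ m + 1
    m+2∸1≡m+1 m = +-∸-assoc m (s≤s z≤n)
    regroup : ∀ h k → h * (k + 1) + 1 ≡ h + 1 + h * k
    regroup = solve-∀
    numerator : (h * (k + 1) + 2 ∸ 1) ! ≡ (n C r) * (r ! * (h * k) !)
    numerator = begin
      (h * (k + 1) + 2 ∸ 1) !       ≡⟨ cong _! (trans (m+2∸1≡m+1 (h * (k + 1))) (regroup h k)) ⟩
      n !                           ≡⟨ nCk*k![n∸k]!≡n! (m≤m+n r (h * k)) ⟨
      (n C r) * (r ! * (n ∸ r) !)   ≡⟨ cong (λ m → (n C r) * (r ! * m !)) (m+n∸m≡n r (h * k)) ⟩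
      (n C r) * (r ! * (h * k) !)   ∎
    denominator : (h + 2 ∸ 1) ! * (h * k) ! ≡ r ! * (h * k) !
    denominator = cong (λ m → m ! * (h * k) !) (m+2∸1≡m+1 h)

  Cᵈ≡altBinomialSum : ∀ d n →
    Cᵈ d (suc n) ≡ fromℤ (altBinomialSum n (λ k → + unrestrictedWalks (d ℕ./ 2) k))
  Cᵈ≡altBinomialSum d n = Σ<-fromℤ (suc n) {g = λ k → coefficient k ℤ.* binomial k} term
    where
    h = d ℕ./ 2
    coefficient = λ k → + (n C k) ℤ.* (-1ℤ ℤ.^ k)
    binomial = λ k → + unrestrictedWalks h k
    term : ∀ k → fromℤ (coefficient k) ℚ.* Γratio (h * (k + 1) + 2) (h + 2) (1 + h * k)
               ≡ fromℤ (coefficient k ℤ.* binomial k)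
    term k = begin
      fromℤ (coefficient k) ℚ.* Γratio (h * (k + 1) + 2) (h + 2) (1 + h * k)
        ≡⟨ cong (fromℤ (coefficient k) ℚ.*_) (Γratio≡unrestrictedWalks h k) ⟩
      fromℤ (coefficient k) ℚ.* fromℤ (binomial k)
        ≡⟨ fromℤ-* (coefficient k) (binomial k) ⟨
      fromℤ (coefficient k ℤ.* binomial k) ∎

module _ where
  open import Data.Bool using (Bool; true; false)
  open import Data.Nat using (zero; suc; _+_; _*_; _≤_; _<ᵇ_; z<s)
  open import Data.Nat.Properties
  open import Data.Empty using (⊥-elim)

  keepIf : Bool → ℕ → ℕ
  keepIf true  x = x
  keepIf false x = 0

  keepIf-+ : ∀ t x y → keepIf t (x + y) ≡ keepIf t x + keepIf t y
  keepIf-+ true  x y = refl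
  keepIf-+ false x y = refl

  keepIf-< : ∀ {c h} x → c < h → keepIf (c <ᵇ h) x ≡ x
  keepIf-< {c} {h} x c<h with c <ᵇ h | <⇒<ᵇ c<h
  ... | true | _ = refl

  keepIf-≥ : ∀ {c h} x → h ≤ c → keepIf (c <ᵇ h) x ≡ 0
  keepIf-≥ {c} {h} x h≤c with c <ᵇ h | <ᵇ⇒< c h
  ... | false | _   = refl
  ... | true  | c<h = ⊥-elim (<⇒≱ (c<h _) h≤c)

  k*[1+m]<b+c⇒k*m<b : ∀ k m b c → c ≤ k → k * suc m < b + c → k * m < b
  k*[1+m]<b+c⇒k*m<b k m b c c≤k k[1+m]<b+c = +-cancelˡ-< k (k * m) b (begin-strict
    k + k * m   ≡⟨ *-suc k m ⟨
    k * suc m   <⟨ k[1+m]<b+c ⟩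
    b + c       ≤⟨ +-monoʳ-≤ b c≤k ⟩
    b + k       ≡⟨ +-comm b k ⟩
    k + b       ∎)
    where open ≤-Reasoning

  k*[1+m]<[1+k]*[x+n] : ∀ k m n x → m < n → k * suc m < suc k * (x + n)
  k*[1+m]<[1+k]*[x+n] k m n x m<n = begin-strict
    k * suc m         <⟨ m<n+m (k * suc m) z<s ⟩
    suc k * suc m     ≤⟨ *-monoʳ-≤ (suc k) m<n ⟩
    suc k * n         ≤⟨ *-monoʳ-≤ (suc k) (m≤n+m n x) ⟩
    suc k * (x + n)   ∎
    where open ≤-Reasoning

module CappedWalks (h' : ℕ) where
  open import Data.Bool using (Bool; true)
  open import Data.Nat using (zero; suc; _+_; _*_; _≤_; _<ᵇ_; z≤n; s≤s; z<s; _<?_; _≤?_)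
  open import Data.Nat.Properties
  open import Data.Nat.Combinatorics using (_C_; nCn≡1; nCk+nC[k+1]≡[n+1]C[k+1])
  open import Algebra.Properties.CommutativeSemigroup +-commutativeSemigroup
    using (xy∙z≈xz∙y) renaming (interchange to +-interchange)
  open import Relation.Nullary using (yes; no)
  open ≡-Reasoning

  h : ℕ
  h = suc h'

  columnOK : ℕ → ℕ → Bool
  columnOK zero    c = true
  columnOK (suc n) c = c <ᵇ h

  -- walks a b n c counts the walks with a right and b up steps that start in a column already
  -- holding c up steps and in which each of the first n columns, the current one included,
  -- ends with fewer than h up steps.
  walks : ℕ → ℕ → ℕ → ℕ → ℕ
  walks zero    zero    n c = keepIf (columnOK n c) 1
  walks zero    (suc b) n c = walks zero b n (suc c)
  walks (suc a) zero    n c = keepIf (columnOK n c) (walks a zero (n ∸ 1) 0)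
  walks (suc a) (suc b) n c = keepIf (columnOK n c) (walks a (suc b) (n ∸ 1) 0) + walks (suc a) b n (suc c)

  walks-uncapped : ∀ a b c → walks a b 0 c ≡ (a + b) C a
  walks-uncapped zero    zero    c = refl
  walks-uncapped zero    (suc b) c = walks-uncapped zero b (suc c)
  walks-uncapped (suc a) zero    c =
    trans (walks-uncapped a 0 0) (trans ([m+0]Cm≡1 a) (sym ([m+0]Cm≡1 (suc a))))
    where
    [m+0]Cm≡1 : ∀ m → (m + 0) C m ≡ 1
    [m+0]Cm≡1 m = trans (cong (_C m) (+-identityʳ m)) (nCn≡1 m)
  walks-uncapped (suc a) (suc b) c = begin
    walks a (suc b) 0 0 + walks (suc a) b 0 (suc c)
      ≡⟨ cong₂ _+_ (walks-uncapped a (suc b) 0) (walks-uncapped (suc a) b (suc c)) ⟩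
    (a + suc b) C a + suc (a + b) C suc a
      ≡⟨ cong (λ m → (a + suc b) C a + m C suc a) (+-suc a b) ⟨
    (a + suc b) C a + (a + suc b) C suc a
      ≡⟨ nCk+nC[k+1]≡[n+1]C[k+1] (a + suc b) a ⟩
    suc (a + suc b) C suc a ∎

  walks-overfull : ∀ a b n c → h ≤ c → walks a b (suc n) c ≡ 0
  walks-overfull zero    zero    n c h≤c = keepIf-≥ 1 h≤c
  walks-overfull zero    (suc b) n c h≤c = walks-overfull zero b n (suc c) (m≤n⇒m≤1+n h≤c)
  walks-overfull (suc a) zero    n c h≤c = keepIf-≥ (walks a 0 n 0) h≤c
  walks-overfull (suc a) (suc b) n c h≤c =
    cong₂ _+_ (keepIf-≥ (walks a (suc b) n 0) h≤c) (walks-overfull (suc a) b n (suc c) (m≤n⇒m≤1+n h≤c))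

  walks-cap-redundant-current : ∀ a b c → b + c < h → walks a b 0 c ≡ walks a b 1 c
  walks-cap-redundant-current zero    zero    c c<h = sym (keepIf-< 1 c<h)
  walks-cap-redundant-current zero    (suc b) c b+c<h =
    walks-cap-redundant-current zero b (suc c) (subst (_< h) (sym (+-suc b c)) b+c<h)
  walks-cap-redundant-current (suc a) zero    c c<h = sym (keepIf-< (walks a 0 0 0) c<h)
  walks-cap-redundant-current (suc a) (suc b) c b+c<h = cong₂ _+_
    (sym (keepIf-< (walks a (suc b) 0 0) (≤-<-trans (m≤n+m c (suc b)) b+c<h)))
    (walks-cap-redundant-current (suc a) b (suc c) (subst (_< h) (sym (+-suc b c)) b+c<h))

  mutual
    walks-cap-redundant : ∀ a b n → b < h → walks a b n 0 ≡ walks a b (suc n) 0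
    walks-cap-redundant a b zero    b<h =
      walks-cap-redundant-current a b 0 (subst (_< h) (sym (+-identityʳ b)) b<h)
    walks-cap-redundant a b (suc n) b<h = walks-cap-redundant-later a b n 0 b<h

    walks-cap-redundant-later : ∀ a b n c → b < h → walks a b (suc n) c ≡ walks a b (suc (suc n)) c
    walks-cap-redundant-later zero    zero    n c b<h = refl
    walks-cap-redundant-later zero    (suc b) n c b<h = walks-cap-redundant-later zero b n (suc c) (<⇒≤ b<h)
    walks-cap-redundant-later (suc a) zero    n c b<h = cong (keepIf (c <ᵇ h)) (walks-cap-redundant a 0 n b<h)
    walks-cap-redundant-later (suc a) (suc b) n c b<h = cong₂ _+_
      (cong (keepIf (c <ᵇ h)) (walks-cap-redundant a (suc b) n b<h))
      (walks-cap-redundant-later (suc a) b n (suc c) (<⇒≤ b<h))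

  -- Deleting the k up steps that fill the current column up to h maps the walks overflowing it
  -- bijectively onto all walks with k fewer up steps.
  walks-peel-current : ∀ a b k c → c + k ≡ h →
    walks a (b + k) 0 c ≡ walks a (b + k) 1 c + walks a b 0 0
  walks-peel-current a b zero c c≡h = begin
    walks a (b + 0) 0 c                 ≡⟨ walks-uncapped a (b + 0) c ⟩
    (a + (b + 0)) C a                   ≡⟨ cong (λ m → (a + m) C a) (+-identityʳ b) ⟩
    (a + b) C a                         ≡⟨ walks-uncapped a b 0 ⟨
    walks a b 0 0                       ≡⟨ cong (_+ walks a b 0 0) (walks-overfull a (b + 0) 0 c h≤c) ⟨
    walks a (b + 0) 1 c + walks a b 0 0 ∎
    where h≤c = ≤-reflexive (trans (sym c≡h) (+-identityʳ c))
  walks-peel-current zero b (suc k) c c+k≡h rewrite +-suc b k =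
    walks-peel-current zero b k (suc c) (trans (sym (+-suc c k)) c+k≡h)
  walks-peel-current (suc a) b (suc k) c c+k≡h rewrite +-suc b k = begin
    walks a (suc (b + k)) 0 0 + walks (suc a) (b + k) 0 (suc c)
      ≡⟨ cong₂ _+_ (sym (keepIf-< _ c<h)) (walks-peel-current (suc a) b k (suc c) c+1+k≡h) ⟩
    keepIf (c <ᵇ h) (walks a (suc (b + k)) 0 0) + (walks (suc a) (b + k) 1 (suc c) + walks (suc a) b 0 0)
      ≡⟨ +-assoc (keepIf (c <ᵇ h) (walks a (suc (b + k)) 0 0)) _ _ ⟨
    keepIf (c <ᵇ h) (walks a (suc (b + k)) 0 0) + walks (suc a) (b + k) 1 (suc c) + walks (suc a) b 0 0 ∎
    where
    c<h : c < h
    c<h = subst (c <_) c+k≡h (m<m+n c z<s)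
    c+1+k≡h : suc c + k ≡ h
    c+1+k≡h = trans (sym (+-suc c k)) c+k≡h

  -- The walks on the left that violate the cap on column m correspond to those counted by
  -- walks a b m 0, by deleting h up steps from column m.
  mutual
    walks-peel : ∀ a b m → m ≤ a → walks a (b + h) m 0 ≡ walks a (b + h) (suc m) 0 + walks a b m 0
    walks-peel a b zero    _   = walks-peel-current a b h 0 refl
    walks-peel a b (suc m) m<a = walks-peel-later a b m 0 m<a

    walks-peel-later : ∀ a b m c → suc m ≤ a →
      walks a (b + h) (suc m) c ≡ walks a (b + h) (suc (suc m)) c + walks a b (suc m) c
    walks-peel-later (suc a) zero    m c (s≤s m≤a) = begin
      keepIf t (walks a h m 0) + walks (suc a) h' (suc m) (suc c)
        ≡⟨ cong₂ _+_ (cong (keepIf t) (walks-peel a 0 m m≤a))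
                     (walks-cap-redundant-later (suc a) h' m (suc c) ≤-refl) ⟩
      keepIf t (x + y) + z          ≡⟨ cong (_+ z) (keepIf-+ t x y) ⟩
      keepIf t x + keepIf t y + z   ≡⟨ xy∙z≈xz∙y (keepIf t x) (keepIf t y) z ⟩
      keepIf t x + z + keepIf t y   ∎
      where
      t = c <ᵇ h
      x = walks a h (suc m) 0
      y = walks a 0 m 0
      z = walks (suc a) h' (suc (suc m)) (suc c)
    walks-peel-later (suc a) (suc b) m c (s≤s m≤a) = begin
      keepIf t (walks a (suc b + h) m 0) + walks (suc a) (b + h) (suc m) (suc c)
        ≡⟨ cong₂ _+_ (cong (keepIf t) (walks-peel a (suc b) m m≤a))
                     (walks-peel-later (suc a) b m (suc c) (s≤s m≤a)) ⟩
      keepIf t (x + y) + (z + w)     ≡⟨ cong (_+ (z + w)) (keepIf-+ t x y) ⟩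
      keepIf t x + keepIf t y + (z + w) ≡⟨ +-interchange (keepIf t x) (keepIf t y) z w ⟩
      keepIf t x + z + (keepIf t y + w) ∎
      where
      t = c <ᵇ h
      x = walks a (suc b + h) (suc m) 0
      y = walks a (suc b) m 0
      z = walks (suc a) (b + h) (suc (suc m)) (suc c)
      w = walks (suc a) b (suc m) (suc c)

  -- Once all a + 1 columns are capped, at most h' (a + 1) up steps fit.
  walks-vanish : ∀ a b n c → a < n → h' * suc a < b + c → walks a b n c ≡ 0
  walks-vanish zero    zero    (suc n) c _ h'<c =
    keepIf-≥ 1 (subst (λ m → suc m ≤ c) (*-identityʳ h') h'<c)
  walks-vanish zero    (suc b) (suc n) c a<n bound =
    walks-vanish zero b (suc n) (suc c) a<n (subst (h' * 1 <_) (sym (+-suc b c)) bound)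
  walks-vanish (suc a) zero    (suc n) c _ bound =
    keepIf-≥ (walks a 0 n 0) (≤-<-trans (m≤m*n h' (suc (suc a))) bound)
  walks-vanish (suc a) (suc b) (suc n) c (s≤s a<n) bound with c <? h
  ... | no  c≮h = walks-overfull (suc a) (suc b) n c (≮⇒≥ c≮h)
  ... | yes c<h = cong₂ _+_
    (trans (keepIf-< _ c<h) (walks-vanish a (suc b) n 0 a<n
      (subst (h' * suc a <_) (sym (+-identityʳ (suc b))) column-bound)))
    (walks-vanish (suc a) b (suc n) (suc c) (s≤s a<n) (subst (h' * suc (suc a) <_) (sym (+-suc b c)) bound))
    where column-bound = k*[1+m]<b+c⇒k*m<b h' (suc a) (suc b) c (≤-pred c<h) bound

  cappedWalks : ℕ → ℕ → ℕ → ℕ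
  cappedWalks a n x = walks a (h * (x + n)) n 0

  cappedWalks-uncapped : ∀ a x → cappedWalks a 0 x ≡ (a + h * x) C a
  cappedWalks-uncapped a x =
    trans (walks-uncapped a (h * (x + 0)) 0) (cong (λ m → (a + h * m) C a) (+-identityʳ x))

  cappedWalks-vanish : ∀ a n x → a < n → cappedWalks a n x ≡ 0
  cappedWalks-vanish a n x a<n = walks-vanish a (h * (x + n)) n 0 a<n
    (subst (h' * suc a <_) (sym (+-identityʳ (h * (x + n)))) (k*[1+m]<[1+k]*[x+n] h' a n x a<n))

  cappedWalks-difference : ∀ a n x → cappedWalks a n (suc x) ≡ cappedWalks a (suc n) x + cappedWalks a n x
  cappedWalks-difference a n x with n ≤? a
  ... | yes n≤a = begin
    walks a (h * (suc x + n)) n 0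
      ≡⟨ cong (λ b → walks a b n 0) (h*[1+m]≡h*m+h (x + n)) ⟩
    walks a (h * (x + n) + h) n 0
      ≡⟨ walks-peel a (h * (x + n)) n n≤a ⟩
    walks a (h * (x + n) + h) (suc n) 0 + walks a (h * (x + n)) n 0
      ≡⟨ cong (λ b → walks a b (suc n) 0 + cappedWalks a n x) h*[x+1+n]≡h*[x+n]+h ⟨
    walks a (h * (x + suc n)) (suc n) 0 + walks a (h * (x + n)) n 0 ∎
    where
    h*[1+m]≡h*m+h : ∀ m → h * suc m ≡ h * m + h
    h*[1+m]≡h*m+h m = trans (*-suc h m) (+-comm h (h * m))
    h*[x+1+n]≡h*[x+n]+h : h * (x + suc n) ≡ h * (x + n) + h
    h*[x+1+n]≡h*[x+n]+h = trans (cong (h *_) (+-suc x n)) (h*[1+m]≡h*m+h (x + n))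
  ... | no  n≰a = trans (cappedWalks-vanish a n (suc x) a<n) (sym (cong₂ _+_
      (cappedWalks-vanish a (suc n) x (m<n⇒m<1+n a<n)) (cappedWalks-vanish a n x a<n)))
    where a<n = ≰⇒> n≰a

  signed-altBinomialSum≡cappedWalks : ∀ n →
    (-1ℤ ℤ.^ n) ℤ.* altBinomialSum n (λ k → + unrestrictedWalks h k) ≡ + cappedWalks (h + 1) n 0
  signed-altBinomialSum≡cappedWalks n = begin
    (-1ℤ ℤ.^ n) ℤ.* altBinomialSum n (λ k → + unrestrictedWalks h k)
      ≡⟨ cong ((-1ℤ ℤ.^ n) ℤ.*_)
              (altBinomialSum-cong n (λ k → cong +_ (cappedWalks-uncapped (h + 1) k))) ⟨
    (-1ℤ ℤ.^ n) ℤ.* altBinomialSum n (λ k → + cappedWalks (h + 1) 0 k)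
      ≡⟨ altBinomialSum-forwardDifference (cappedWalks (h + 1)) (cappedWalks-difference (h + 1)) n 0 ⟩
    + cappedWalks (h + 1) n 0 ∎

module _ where
  open import Data.Bool using (Bool; true; false; _∧_; T?)
  open import Data.List using (List; []; _∷_; filter; length; concatMap)
  open import Data.Nat using (zero; suc; _+_)
  open import Data.Nat.Properties using (+-assoc; +-commutativeSemigroup)
  open import Algebra.Properties.CommutativeSemigroup +-commutativeSemigroup using (x∙yz≈y∙xz)
  open ≡-Reasoning

  count : ∀ {A : Set} → (A → Bool) → List A → ℕ
  count P []       = 0
  count P (x ∷ xs) = keepIf (P x) 1 + count P xs

  length-filter≡count : ∀ {A : Set} (P : A → Bool) xs → length (filter (λ x → T? (P x)) xs) ≡ count P xs
  length-filter≡count P []       = refl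
  length-filter≡count P (x ∷ xs) with P x
  ... | true  = cong suc (length-filter≡count P xs)
  ... | false = length-filter≡count P xs

  count-cong : ∀ {A : Set} {P Q : A → Bool} xs → (∀ x → P x ≡ Q x) → count P xs ≡ count Q xs
  count-cong []       P≗Q = refl
  count-cong (x ∷ xs) P≗Q = cong₂ _+_ (cong (λ b → keepIf b 1) (P≗Q x)) (count-cong xs P≗Q)

  count-false : ∀ {A : Set} (xs : List A) → count (λ _ → false) xs ≡ 0
  count-false []       = refl
  count-false (x ∷ xs) = count-false xs

  count-∧ : ∀ {A : Set} t (P : A → Bool) xs → count (λ x → t ∧ P x) xs ≡ keepIf t (count P xs)
  count-∧ true  P xs = refl
  count-∧ false P xs = count-false xs

  allB-true : ∀ js → allB (λ _ → true) js ≡ true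
  allB-true []       = refl
  allB-true (j ∷ js) = allB-true js

  count-allSeqs-suc : ∀ (P : List Step → Bool) m →
    count P (allSeqs (suc m)) ≡ count (λ w → P (R ∷ w)) (allSeqs m) + count (λ w → P (U ∷ w)) (allSeqs m)
  count-allSeqs-suc P m = go (allSeqs m)
    where
    go : ∀ ws → count P (concatMap (λ w → (R ∷ w) ∷ (U ∷ w) ∷ []) ws)
               ≡ count (λ w → P (R ∷ w)) ws + count (λ w → P (U ∷ w)) ws
    go [] = refl
    go (w ∷ ws) = begin
      r + (u + count P (concatMap (λ w → (R ∷ w) ∷ (U ∷ w) ∷ []) ws))
        ≡⟨ cong (λ s → r + (u + s)) (go ws) ⟩
      r + (u + (rs + us))
        ≡⟨ cong (_+_ r) (x∙yz≈y∙xz u rs us) ⟩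
      r + (rs + (u + us))
        ≡⟨ +-assoc r rs (u + us) ⟨
      r + rs + (u + us) ∎
      where
      r  = keepIf (P (R ∷ w)) 1
      u  = keepIf (P (U ∷ w)) 1
      rs = count (λ w → P (R ∷ w)) ws
      us = count (λ w → P (U ∷ w)) ws

module WalkEnumeration (h' : ℕ) where
  open import Algebra.Bundles using (CommutativeMonoid)
  open import Data.Bool using (Bool; true; false; _∧_; T?)
  open import Data.Bool.Properties using (∧-zeroʳ; ∧-identityʳ; ∧-commutativeMonoid)
  open import Data.List using (List; []; _∷_; upTo; filter; length)
  open import Data.List.Properties using (foldr-map; map-upTo)
  open import Data.Nat using (_+_; _*_; _/_; _<ᵇ_; _≡ᵇ_)
  open import Data.Nat.Properties using (+-suc; +-identityʳ; *-commutativeSemigroup)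
  open import Algebra.Properties.CommutativeSemigroup *-commutativeSemigroup using (xy∙z≈xz∙y)
  open import Algebra.Properties.CommutativeSemigroup (CommutativeMonoid.commutativeSemigroup ∧-commutativeMonoid)
    using () renaming (x∙yz≈y∙xz to x∧yz≡y∧xz)
  open ≡-Reasoning
  open CappedWalks h'

  accepts : List Step → ℕ → ℕ → ℕ → ℕ → Bool
  accepts []      zero    zero    n c = columnOK n c
  accepts (R ∷ w) (suc a) b       n c = columnOK n c ∧ accepts w a b (n ∸ 1) 0
  accepts (U ∷ w) a       (suc b) n c = accepts w a b n (suc c)
  accepts _       _       _       _ _ = false

  count-accepts : ∀ a b n c → count (λ w → accepts w a b n c) (allSeqs (a + b)) ≡ walks a b n c
  count-accepts zero    zero    n c = +-identityʳ _
  count-accepts zero    (suc b) n c = begin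
    count (λ w → accepts w 0 (suc b) n c) (allSeqs (suc b))
      ≡⟨ count-allSeqs-suc (λ w → accepts w 0 (suc b) n c) b ⟩
    count (λ _ → false) (allSeqs b) + count (λ w → accepts w 0 b n (suc c)) (allSeqs b)
      ≡⟨ cong₂ _+_ (count-false (allSeqs b)) (count-accepts zero b n (suc c)) ⟩
    walks zero b n (suc c) ∎
  count-accepts (suc a) zero    n c = begin
    count (λ w → accepts w (suc a) 0 n c) (allSeqs (suc (a + 0)))
      ≡⟨ count-allSeqs-suc (λ w → accepts w (suc a) 0 n c) (a + 0) ⟩
    count (λ w → t ∧ accepts w a 0 (n ∸ 1) 0) (allSeqs (a + 0)) + count (λ _ → false) (allSeqs (a + 0))
      ≡⟨ cong₂ _+_ (count-∧ t (λ w → accepts w a 0 (n ∸ 1) 0) (allSeqs (a + 0)))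
                   (count-false (allSeqs (a + 0))) ⟩
    keepIf t (count (λ w → accepts w a 0 (n ∸ 1) 0) (allSeqs (a + 0))) + 0
      ≡⟨ +-identityʳ _ ⟩
    keepIf t (count (λ w → accepts w a 0 (n ∸ 1) 0) (allSeqs (a + 0)))
      ≡⟨ cong (keepIf t) (count-accepts a 0 (n ∸ 1) 0) ⟩
    walks (suc a) zero n c ∎
    where t = columnOK n c
  count-accepts (suc a) (suc b) n c = begin
    count (λ w → accepts w (suc a) (suc b) n c) (allSeqs (suc (a + suc b)))
      ≡⟨ count-allSeqs-suc (λ w → accepts w (suc a) (suc b) n c) (a + suc b) ⟩
    count (λ w → t ∧ accepts w a (suc b) (n ∸ 1) 0) (allSeqs (a + suc b))
      + count (λ w → accepts w (suc a) b n (suc c)) (allSeqs (a + suc b))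
      ≡⟨ cong₂ _+_ (count-∧ t (λ w → accepts w a (suc b) (n ∸ 1) 0) (allSeqs (a + suc b)))
                   (cong (λ m → count (λ w → accepts w (suc a) b n (suc c)) (allSeqs m)) (+-suc a b)) ⟩
    keepIf t (count (λ w → accepts w a (suc b) (n ∸ 1) 0) (allSeqs (a + suc b)))
      + count (λ w → accepts w (suc a) b n (suc c)) (allSeqs (suc a + b))
      ≡⟨ cong₂ _+_ (cong (keepIf t) (count-accepts a (suc b) (n ∸ 1) 0))
                   (count-accepts (suc a) b n (suc c)) ⟩
    walks (suc a) (suc b) n c ∎
    where t = columnOK n c

  columnsOK : ℕ → ℕ → List Step → Bool
  columnsOK zero    c w = true
  columnsOK (suc n) c w = (upsAt 0 w + c <ᵇ h) ∧ allB (λ j → upsAt (suc j) w <ᵇ h) (upTo n)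

  columnsOK-start : ∀ n w → allB (λ j → upsAt j w <ᵇ h) (upTo n) ≡ columnsOK n 0 w
  columnsOK-start zero    w = refl
  columnsOK-start (suc n) w = cong₂ _∧_
    (cong (_<ᵇ h) (sym (+-identityʳ (upsAt 0 w))))
    (trans (cong (allB p) (sym (map-upTo suc n))) (foldr-map _ suc true (upTo n)))
    where p = λ j → upsAt j w <ᵇ h

  columnsOK-U : ∀ n c w → columnsOK n c (U ∷ w) ≡ columnsOK n (suc c) w
  columnsOK-U zero    c w = refl
  columnsOK-U (suc n) c w =
    cong (λ u → (u <ᵇ h) ∧ allB (λ j → upsAt (suc j) w <ᵇ h) (upTo n)) (sym (+-suc (upsAt 0 w) c))

  accepts-spec : ∀ w a b n c → accepts w a b n c ≡ (numR w ≡ᵇ a) ∧ (numU w ≡ᵇ b) ∧ columnsOK n c w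
  accepts-spec []      zero    zero    zero    c = refl
  accepts-spec []      zero    zero    (suc n) c =
    sym (trans (cong ((c <ᵇ h) ∧_) (allB-true (upTo n))) (∧-identityʳ _))
  accepts-spec []      zero    (suc b) n       c = refl
  accepts-spec []      (suc a) b       n       c = refl
  accepts-spec (R ∷ w) zero    b       n       c = refl
  accepts-spec (R ∷ w) (suc a) b       zero    c = accepts-spec w a b 0 0
  accepts-spec (R ∷ w) (suc a) b       (suc n) c = begin
    (c <ᵇ h) ∧ accepts w a b n 0
      ≡⟨ cong ((c <ᵇ h) ∧_) (accepts-spec w a b n 0) ⟩
    (c <ᵇ h) ∧ (x ∧ (y ∧ columnsOK n 0 w))
      ≡⟨ x∧yz≡y∧xz (c <ᵇ h) x _ ⟩
    x ∧ ((c <ᵇ h) ∧ (y ∧ columnsOK n 0 w))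
      ≡⟨ cong (x ∧_) (x∧yz≡y∧xz (c <ᵇ h) y _) ⟩
    x ∧ (y ∧ ((c <ᵇ h) ∧ columnsOK n 0 w))
      ≡⟨ cong (λ z → x ∧ (y ∧ ((c <ᵇ h) ∧ z))) (columnsOK-start n w) ⟨
    x ∧ (y ∧ columnsOK (suc n) c (R ∷ w)) ∎
    where
    x = numR w ≡ᵇ a
    y = numU w ≡ᵇ b
  accepts-spec (U ∷ w) a       zero    n       c = sym (∧-zeroʳ _)
  accepts-spec (U ∷ w) a       (suc b) n       c =
    trans (accepts-spec w a b n (suc c))
          (cong (λ z → (numR w ≡ᵇ a) ∧ ((numU w ≡ᵇ b) ∧ z)) (sym (columnsOK-U n c w)))

  goodWalk≡accepts : ∀ a b n w → goodWalk a b (suc n) h w ≡ accepts w a b n 0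
  goodWalk≡accepts a b n w =
    trans (cong (λ z → (numR w ≡ᵇ a) ∧ ((numU w ≡ᵇ b) ∧ z)) (columnsOK-start n w))
          (sym (accepts-spec w a b n 0))

  goodWalks≡walks : ∀ a b n →
    length (filter (λ w → T? (goodWalk a b (suc n) h w)) (allSeqs (a + b))) ≡ walks a b n 0
  goodWalks≡walks a b n = begin
    length (filter (λ w → T? (goodWalk a b (suc n) h w)) (allSeqs (a + b)))
      ≡⟨ length-filter≡count _ (allSeqs (a + b)) ⟩
    count (λ w → goodWalk a b (suc n) h w) (allSeqs (a + b))
      ≡⟨ count-cong (allSeqs (a + b)) (goodWalk≡accepts a b n) ⟩
    count (λ w → accepts w a b n 0) (allSeqs (a + b))
      ≡⟨ count-accepts a b n 0 ⟩
    walks a b n 0 ∎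

  numWalks≡cappedWalks : ∀ n → numWalks (h * 2) (suc n) ≡ cappedWalks (h + 1) n 0
  numWalks≡cappedWalks n = begin
    numWalks (h * 2) (suc n)
      ≡⟨ cong₂ goodWalks (m*n/n≡m h 2) h*2*n/2≡h*n ⟩
    goodWalks h (h * n)
      ≡⟨ goodWalks≡walks (h + 1) (h * n) n ⟩
    cappedWalks (h + 1) n 0 ∎
    where
    goodWalks : ℕ → ℕ → ℕ
    goodWalks x y = length (filter (λ w → T? (goodWalk (x + 1) y (suc n) x w)) (allSeqs (x + 1 + y)))
    h*2*n/2≡h*n : h * 2 * n / 2 ≡ h * n
    h*2*n/2≡h*n = trans (cong (_/ 2) (xy∙z≈xz∙y h 2 n)) (m*n/n≡m (h * n) 2)

mainTheorem7 : (d i : ℕ) → 0 < d → 2 ∣ d → 0 < i →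
    ((-1ℤ ℤ.^ (i ∸ 1)) ℚ./ 1) ℚ.* Cᵈ d i ≡ (+ numWalks d i) ℚ./ 1
mainTheorem7 _ (suc n) _ (divides (suc h') refl) _ = begin
  fromℤ s ℚ.* Cᵈ d (suc n)
    ≡⟨ cong (fromℤ s ℚ.*_) (Cᵈ≡altBinomialSum d n) ⟩
  fromℤ s ℚ.* fromℤ (altBinomialSum n (binomials (d ℕ./ 2)))
    ≡⟨ fromℤ-* s _ ⟨
  fromℤ (s ℤ.* altBinomialSum n (binomials (d ℕ./ 2)))
    ≡⟨ cong (λ x → fromℤ (s ℤ.* altBinomialSum n (binomials x))) (m*n/n≡m h 2) ⟩
  fromℤ (s ℤ.* altBinomialSum n (binomials h))
    ≡⟨ cong fromℤ (signed-altBinomialSum≡cappedWalks n) ⟩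
  fromℤ (+ cappedWalks (h ℕ.+ 1) n 0)
    ≡⟨ cong (λ m → fromℤ (+ m)) (numWalks≡cappedWalks n) ⟨
  fromℤ (+ numWalks d (suc n)) ∎
  where
  open CappedWalks h' using (h; cappedWalks; signed-altBinomialSum≡cappedWalks)
  open WalkEnumeration h' using (numWalks≡cappedWalks)
  open ≡-Reasoning
  d = h ℕ.* 2
  s = -1ℤ ℤ.^ n
  binomials = λ x k → + unrestrictedWalks x k
mainTheorem7 _ (suc n) () (divides zero refl) _
mainTheorem7 _ zero    _  _                    ()
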